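{- Fix $k$ with $2\le k\le n-1$, and let $P$ be any set partition of $S_k$. If, under general $P$-equivalence, $S_{n-1}$ consists of a single equivalence class, then under general $P$-equivalence $S_n$ also consists of a single equivalence class.
   Context: Permutations are written as words $\pi_1\cdots\pi_n$. A sequence $a_1\cdots a_k$ of distinct integers has pattern $\sigma\in S_k$ if $a_s<a_t\iff\sigma_s<\sigma_t$. For a set partition $P$ of $S_k$, a (general) move on $\pi\in S_n$ chooses any positions $i_1<\dots<i_k$ where $\pi_{i_1}\cdots\pi_{i_k}$ has pattern $\sigma$ and rearranges these values among these positions to have pattern $\sigma'$, with $\sigma,\sigma'$ in the same block of $P$. General $P$-equivalence is the equivalence relation generated by such moves. -}

module Defs where

open import Data.Nat using (ℕ)
open import Data.Fin using (Fin; _<_)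
open import Data.Vec using (Vec; lookup)
open import Data.Product using (Σ; ∃; _×_)
open import Relation.Binary.PropositionalEquality using (_≡_; _≢_)
open import Relation.Binary.Construct.Closure.Equivalence using (EqClosure)

Word : ℕ → Set
Word n = Vec (Fin n) n

-- The word is a permutation of S_n (one-line notation): its entries are distinct.
-- (For a word of length n over Fin n this is equivalent to being a bijection.)
IsPerm : {n : ℕ} → Word n → Set
IsPerm {n} π = (i j : Fin n) → lookup π i ≡ lookup π j → i ≡ j

HasPattern : {k n : ℕ} → (Fin k → Fin n) → Word k → Set
HasPattern {k} a σ =
  (s t : Fin k) → (a s < a t → lookup σ s < lookup σ t) × (lookup σ s < lookup σ t → a s < a t)

StrictlyIncreasing : {k n : ℕ} → (Fin k → Fin n) → Set
StrictlyIncreasing {k} idx = (s t : Fin k) → s < t → idx s < idx t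

-- A set partition P of S_k is given by a block labelling: σ and σ' lie in the
-- same block iff  block σ ≡ block σ'  (only the values on permutations matter).
-- A general P-move turning π into τ.
Move : {k n : ℕ} → (Word k → ℕ) → Word n → Word n → Set
Move {k} {n} block π τ =
  Σ (Fin k → Fin n) λ idx → Σ (Word k) λ σ → Σ (Word k) λ σ' →
    StrictlyIncreasing idx × IsPerm σ × IsPerm σ' × block σ ≡ block σ'
    × HasPattern (λ j → lookup π (idx j)) σ
    × HasPattern (λ j → lookup τ (idx j)) σ'
    × ((p : Fin n) → ((j : Fin k) → idx j ≢ p) → lookup τ p ≡ lookup π p)
    × ((j : Fin k) → ∃ λ j' → lookup τ (idx j) ≡ lookup π (idx j'))
    × ((j : Fin k) → ∃ λ j' → lookup π (idx j) ≡ lookup τ (idx j'))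

PEquiv : {k n : ℕ} → (Word k → ℕ) → Word n → Word n → Set
PEquiv block = EqClosure (Move block)

SingleClass : {k : ℕ} → (Word k → ℕ) → (n : ℕ) → Set
SingleClass block n = (π π' : Word n) → IsPerm π → IsPerm π' → PEquiv block π π'

-- Inserting a fixed value v at a fixed position p into a permutation of
-- S_m (shifting the entries ≥ v up by one) embeds S_m into S_(m+1), and this
-- embedding carries P-moves to P-moves: the chosen positions and the pattern
-- of the chosen values are unchanged.  Conversely every π ∈ S_(m+1) is the
-- image of the permutation obtained by deleting its entry at position p.
-- Hence two permutations of S_(m+1) that agree at some position are
-- equivalent, being images of two (equivalent) permutations of S_m.
-- Finally, for m ≥ 2 any π, π' can be linked through two permutations σ₁, σ₂
-- with  σ₁ = a t …  and  σ₂ = b t …,  where a = π(1), b = π'(1) and t avoids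
-- a and b:  π ~ σ₁ (agree at 1), σ₁ ~ σ₂ (agree at 2), σ₂ ~ π' (agree at 1).
module Submission where

open import Defs
open import Data.Nat using (ℕ; suc; _≤_)
import Data.Nat as ℕ
import Data.Nat.Properties as ℕ
open import Data.Fin using (Fin; zero; suc; _<_; punchIn; punchOut; _≟_)
open import Data.Fin.Properties
  using (punchIn-injective; punchInᵢ≢i; punchIn-punchOut; punchOut-injective;
         punchIn-mono-≤; punchIn-cancel-≤; ≤∧≢⇒<; <⇒≢)
open import Data.Vec using (lookup; insertAt; map; tabulate; allFin)
open import Data.Vec.Properties
  using (insertAt-lookup; insertAt-punchIn; lookup-map; lookup∘tabulate;
         tabulate∘lookup; tabulate-cong; lookup-allFin)
open import Data.Product using (Σ; ∃; _×_; _,_; proj₁; proj₂)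
open import Data.Sum using (_⊎_; inj₁; inj₂)
open import Data.Empty using (⊥-elim)
open import Relation.Nullary using (yes; no)
open import Relation.Binary.PropositionalEquality using (_≡_; _≢_; refl; sym; trans; cong; subst₂; module ≡-Reasoning)
open import Relation.Binary.Construct.Closure.Equivalence using (gmap) renaming (setoid to equivalenceSetoid)
import Relation.Binary.Reasoning.Setoid as SetoidReasoning

private
  variable
    k n : ℕ

punchIn-mono-< : ∀ (i : Fin (suc n)) (j l : Fin n) → j < l → punchIn i j < punchIn i l
punchIn-mono-< i j l j<l =
  ≤∧≢⇒< (punchIn-mono-≤ i j l (ℕ.<⇒≤ j<l)) (λ e → <⇒≢ j<l (punchIn-injective i j l e))

punchIn-cancel-< : ∀ (i : Fin (suc n)) (j l : Fin n) → punchIn i j < punchIn i l → j < l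
punchIn-cancel-< i j l lt =
  ≤∧≢⇒< (punchIn-cancel-≤ i j l (ℕ.<⇒≤ lt)) (λ { refl → <⇒≢ lt refl })

position-cases : (p q : Fin (suc n)) → q ≡ p ⊎ Σ (Fin n) λ q' → punchIn p q' ≡ q
position-cases p q with p ≟ q
... | yes p≡q = inj₁ (sym p≡q)
... | no p≢q  = inj₂ (punchOut p≢q , punchIn-punchOut p≢q)

HasPattern-punchIn : (v : Fin (suc n)) (a : Fin k → Fin n) (σ : Word k) →
  HasPattern a σ → HasPattern (λ j → punchIn v (a j)) σ
HasPattern-punchIn v a σ h s t =
  (λ lt → proj₁ (h s t) (punchIn-cancel-< v _ _ lt)) ,
  (λ lt → punchIn-mono-< v _ _ (proj₂ (h s t) lt))

HasPattern-cong : {a b : Fin k → Fin n} (σ : Word k) → (∀ j → a j ≡ b j) →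
  HasPattern a σ → HasPattern b σ
HasPattern-cong σ a≗b h s t rewrite sym (a≗b s) | sym (a≗b t) = h s t

-- On permutations this is the inverse of deleting position p.
insertValue : Fin (suc n) → Fin (suc n) → Word n → Word (suc n)
insertValue p v w = insertAt (map (punchIn v) w) p v

insertValue-at : (p v : Fin (suc n)) (w : Word n) → lookup (insertValue p v w) p ≡ v
insertValue-at p v w = insertAt-lookup _ p v

insertValue-punchIn : (p v : Fin (suc n)) (w : Word n) (i : Fin n) →
  lookup (insertValue p v w) (punchIn p i) ≡ punchIn v (lookup w i)
insertValue-punchIn p v w i = trans (insertAt-punchIn _ p v i) (lookup-map i (punchIn v) w)

insertValue-perm : (p v : Fin (suc n)) (w : Word n) → IsPerm w → IsPerm (insertValue p v w)
insertValue-perm p v w w-perm i j e with position-cases p i | position-cases p j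
... | inj₁ refl | inj₁ refl = refl
... | inj₁ refl | inj₂ (j' , refl) =
  ⊥-elim (punchInᵢ≢i v (lookup w j')
    (sym (trans (sym (insertValue-at p v w)) (trans e (insertValue-punchIn p v w j')))))
... | inj₂ (i' , refl) | inj₁ refl =
  ⊥-elim (punchInᵢ≢i v (lookup w i')
    (trans (sym (insertValue-punchIn p v w i')) (trans e (insertValue-at p v w))))
... | inj₂ (i' , refl) | inj₂ (j' , refl) =
  cong (punchIn p) (w-perm i' j' (punchIn-injective v _ _
    (trans (sym (insertValue-punchIn p v w i')) (trans e (insertValue-punchIn p v w j')))))

-- Inserting the same value at the same position turns a P-move into a P-move:
-- the chosen positions are shifted by punchIn p, the patterns are unchanged,
-- and the new position p carries v on both sides.
insertValue-move : (block : Word k → ℕ) (p v : Fin (suc n)) (w τ : Word n) →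
  Move block w τ → Move block (insertValue p v w) (insertValue p v τ)
insertValue-move block p v w τ
  (idx , σ , σ' , idx-inc , σ-perm , σ'-perm , same-block , w-pat , τ-pat , τ-outside , τ⊆w , w⊆τ) =
  idx⁺ , σ , σ' , idx⁺-inc , σ-perm , σ'-perm , same-block ,
  same-pattern w σ w-pat , same-pattern τ σ' τ-pat , outside , rearranged τ w τ⊆w , rearranged w τ w⊆τ
  where
  idx⁺ : Fin _ → Fin (suc _)
  idx⁺ j = punchIn p (idx j)

  idx⁺-inc : StrictlyIncreasing idx⁺
  idx⁺-inc s t s<t = punchIn-mono-< p _ _ (idx-inc s t s<t)

  same-pattern : (x : Word _) (ρ : Word _) → HasPattern (λ j → lookup x (idx j)) ρ →
    HasPattern (λ j → lookup (insertValue p v x) (idx⁺ j)) ρ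
  same-pattern x ρ h = HasPattern-cong ρ (λ j → sym (insertValue-punchIn p v x (idx j)))
    (HasPattern-punchIn v _ ρ h)

  outside : (q : Fin _) → ((j : Fin _) → idx⁺ j ≢ q) →
    lookup (insertValue p v τ) q ≡ lookup (insertValue p v w) q
  outside q q-free with position-cases p q
  ... | inj₁ refl = trans (insertValue-at p v τ) (sym (insertValue-at p v w))
  ... | inj₂ (q' , refl) = begin
    lookup (insertValue p v τ) (punchIn p q') ≡⟨ insertValue-punchIn p v τ q' ⟩
    punchIn v (lookup τ q')                   ≡⟨ cong (punchIn v) (τ-outside q' (λ j e → q-free j (cong (punchIn p) e))) ⟩
    punchIn v (lookup w q')                   ≡⟨ insertValue-punchIn p v w q' ⟨
    lookup (insertValue p v w) (punchIn p q') ∎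
    where open ≡-Reasoning

  rearranged : (x y : Word _) → ((j : Fin _) → ∃ λ j' → lookup x (idx j) ≡ lookup y (idx j')) →
    (j : Fin _) → ∃ λ j' → lookup (insertValue p v x) (idx⁺ j) ≡ lookup (insertValue p v y) (idx⁺ j')
  rearranged x y x⊆y j with x⊆y j
  ... | j' , e = j' , trans (insertValue-punchIn p v x (idx j))
                        (trans (cong (punchIn v) e) (sym (insertValue-punchIn p v y (idx j'))))

insertValue-equiv : (block : Word k → ℕ) (p v : Fin (suc n)) {w τ : Word n} →
  PEquiv block w τ → PEquiv block (insertValue p v w) (insertValue p v τ)
insertValue-equiv block p v = gmap (insertValue p v) (insertValue-move block p v _ _)

entry-distinct : (p : Fin (suc n)) (π : Word (suc n)) → IsPerm π → (i : Fin n) →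
  lookup π p ≢ lookup π (punchIn p i)
entry-distinct p π π-perm i e = punchInᵢ≢i p i (sym (π-perm _ _ e))

deleteAt : (p : Fin (suc n)) (π : Word (suc n)) → IsPerm π → Word n
deleteAt p π π-perm = tabulate λ i → punchOut (entry-distinct p π π-perm i)

deleteAt-perm : (p : Fin (suc n)) (π : Word (suc n)) (π-perm : IsPerm π) →
  IsPerm (deleteAt p π π-perm)
deleteAt-perm p π π-perm i j e =
  punchIn-injective p i j (π-perm _ _
    (punchOut-injective (entry-distinct p π π-perm i) (entry-distinct p π π-perm j)
      (trans (sym (lookup∘tabulate _ i)) (trans e (lookup∘tabulate _ j)))))

insertValue-deleteAt : (p : Fin (suc n)) (π : Word (suc n)) (π-perm : IsPerm π) →
  insertValue p (lookup π p) (deleteAt p π π-perm) ≡ π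
insertValue-deleteAt p π π-perm =
  trans (sym (tabulate∘lookup _)) (trans (tabulate-cong same-entries) (tabulate∘lookup π))
  where
  same-entries : (q : Fin _) → lookup (insertValue p (lookup π p) (deleteAt p π π-perm)) q ≡ lookup π q
  same-entries q with position-cases p q
  ... | inj₁ refl = insertValue-at p _ _
  ... | inj₂ (q' , refl) =
    trans (insertValue-punchIn p _ _ q')
      (trans (cong (punchIn _) (lookup∘tabulate _ q')) (punchIn-punchOut _))

agreeing-equiv : (block : Word k → ℕ) → SingleClass block n →
  (p : Fin (suc n)) (π π' : Word (suc n)) → IsPerm π → IsPerm π' →
  lookup π p ≡ lookup π' p → PEquiv block π π'
agreeing-equiv block single p π π' π-perm π'-perm same-entry =
  subst₂ (PEquiv block) (insertValue-deleteAt p π π-perm) π'-restored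
    (insertValue-equiv block p (lookup π p)
      (single _ _ (deleteAt-perm p π π-perm) (deleteAt-perm p π' π'-perm)))
  where
  π'-restored : insertValue p (lookup π p) (deleteAt p π' π'-perm) ≡ π'
  π'-restored = trans (cong (λ v → insertValue p v (deleteAt p π' π'-perm)) same-entry)
                      (insertValue-deleteAt p π' π'-perm)

startingWith : Fin (suc n) → Word (suc n)
startingWith {n} x = insertValue zero x (allFin n)

startingWith-perm : (x : Fin (suc n)) → IsPerm (startingWith x)
startingWith-perm {n} x = insertValue-perm zero x (allFin n)
  (λ i j e → trans (sym (lookup-allFin i)) (trans e (lookup-allFin j)))

startingWith₂ : (x y : Fin (suc (suc n))) → x ≢ y → Word (suc (suc n))
startingWith₂ x y x≢y = insertValue zero x (startingWith (punchOut x≢y))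

startingWith₂-perm : (x y : Fin (suc (suc n))) (x≢y : x ≢ y) → IsPerm (startingWith₂ x y x≢y)
startingWith₂-perm x y x≢y =
  insertValue-perm zero x _ (startingWith-perm (punchOut x≢y))

startingWith₂-second : (x y : Fin (suc (suc n))) (x≢y : x ≢ y) →
  lookup (startingWith₂ x y x≢y) (suc zero) ≡ y
startingWith₂-second x y x≢y = punchIn-punchOut x≢y

avoid-two : (a b : Fin (suc (suc (suc n)))) → Σ (Fin (suc (suc (suc n)))) λ t → a ≢ t × b ≢ t
avoid-two (suc _)       (suc _)       = zero , (λ ()) , (λ ())
avoid-two zero          zero          = suc zero , (λ ()) , (λ ())
avoid-two zero          (suc (suc _)) = suc zero , (λ ()) , (λ ())
avoid-two (suc (suc _)) zero          = suc zero , (λ ()) , (λ ())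
avoid-two zero          (suc zero)    = suc (suc zero) , (λ ()) , (λ ())
avoid-two (suc zero)    zero          = suc (suc zero) , (λ ()) , (λ ())

-- The inductive step for m = n + 2: link π and π' through the two
-- permutations  π(1) t …  and  π'(1) t …  using the key lemma three times.
single-class-step : (block : Word k → ℕ) →
  SingleClass block (suc (suc n)) → SingleClass block (suc (suc (suc n)))
single-class-step {n = n} block single π π' π-perm π'-perm with avoid-two (lookup π zero) (lookup π' zero)
... | t , a≢t , b≢t = begin
  π   ≈⟨ agree zero π σ₁ π-perm σ₁-perm refl ⟩
  σ₁  ≈⟨ agree (suc zero) σ₁ σ₂ σ₁-perm σ₂-perm
           (trans (startingWith₂-second _ t a≢t) (sym (startingWith₂-second _ t b≢t))) ⟩
  σ₂  ≈⟨ agree zero σ₂ π' σ₂-perm π'-perm refl ⟩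
  π'  ∎
  where
  open SetoidReasoning (equivalenceSetoid (Move {n = suc (suc (suc n))} block))
  agree : (p : Fin _) (ρ ρ' : Word _) → IsPerm ρ → IsPerm ρ' → lookup ρ p ≡ lookup ρ' p →
    PEquiv block ρ ρ'
  agree = agreeing-equiv block single

  σ₁ σ₂ : Word (suc (suc (suc n)))
  σ₁ = startingWith₂ (lookup π zero) t a≢t
  σ₂ = startingWith₂ (lookup π' zero) t b≢t

  σ₁-perm : IsPerm σ₁
  σ₁-perm = startingWith₂-perm _ t a≢t

  σ₂-perm : IsPerm σ₂
  σ₂-perm = startingWith₂-perm _ t b≢t

-- The theorem: k ≥ 2 and k ≤ m force m ≥ 2, where the inductive step applies.
proposition2p1 : (k m : ℕ) → 2 ≤ k → k ≤ m → (block : Word k → ℕ) →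
    SingleClass block m → SingleClass block (suc m)
proposition2p1 k (suc (suc m)) _ _ block = single-class-step block
proposition2p1 (suc (suc k)) 1 (ℕ.s≤s (ℕ.s≤s _)) (ℕ.s≤s ())
proposition2p1 (suc (suc k)) 0 (ℕ.s≤s (ℕ.s≤s _)) ()
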